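{- Let $S$ be a sorting sequence with $r>1$ distinct values and multiplicities $p_1,\dots,p_r$, $p=\sum p_i$, $c=\gcd(p_1,\dots,p_r)$. If a general solution for $S$ with $f$ fake coins exists, then a general solution $(f_1,\dots,f_r)$ for $S$ with the same number $f$ of fake coins and $f_r-f_1\le (2p-p_1-p_r)/c$ also exists.
   Context: A sorting sequence of length $p$ is a non-decreasing sequence of $p$ non-negative integers beginning with $0$ in which each entry equals the previous one or exceeds it by $1$. If its distinct entries are $0,\dots,r-1$, let $p_i\ge1$ be the number of entries equal to $i-1$. A general solution with $f$ fake coins is an integer tuple $(f_1,\dots,f_r)$ with $0\le f_1<\dots<f_r$ and $\sum_i p_if_i=f$. -}

module Defs where

open import Data.Nat using (ℕ; zero; suc; _+_; _*_; _∸_; _≤_; _<_)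
open import Data.Nat.GCD using (gcd)
open import Data.Nat.ListAction using (sum)
open import Data.List using (List; []; _∷_; length; map; foldr; upTo; zipWith; head; last; filter)
open import Data.List.Relation.Unary.Linked using (Linked)
open import Data.Maybe using (Maybe; just; nothing)
open import Data.Product using (_×_)
open import Data.Sum using (_⊎_)
open import Relation.Binary.PropositionalEquality using (_≡_)
open import Data.Nat.Properties using (_≟_)

Step : ℕ → ℕ → Set
Step a b = (b ≡ a) ⊎ (b ≡ suc a)

IsSortingSequence : List ℕ → Set
IsSortingSequence s = (head s ≡ just 0) × Linked Step s

-- number of distinct values r = (last entry) + 1 (0 for the empty list)
numValues : List ℕ → ℕ
numValues s with last s
... | just x = suc x
... | nothing = 0

count : ℕ → List ℕ → ℕ
count v s = length (filter (λ x → x ≟ v) s)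

multiplicities : List ℕ → List ℕ
multiplicities s = map (λ v → count v s) (upTo (numValues s))

gcdList : List ℕ → ℕ
gcdList = foldr gcd 0

weightedSum : List ℕ → List ℕ → ℕ
weightedSum ps fs = sum (zipWith _*_ ps fs)

IsGeneralSolution : List ℕ → ℕ → List ℕ → Set
IsGeneralSolution ps f fs =
  (length fs ≡ length ps) × Linked _<_ fs × (weightedSum ps fs ≡ f)

firstOr0 : List ℕ → ℕ
firstOr0 [] = 0
firstOr0 (x ∷ _) = x

lastOr0 : List ℕ → ℕ
lastOr0 s with last s
... | just x = x
... | nothing = 0

-- Encode a solution by its first value x = f₁ and its gaps eᵢ = fᵢ₊₁ − fᵢ − 1 ≥ 0.  Then
-- Σ pᵢfᵢ = x·p + Σᵢ Sᵢ₊₁ + Σᵢ eᵢ·Sᵢ₊₁, where Sᵢ = pᵢ + ⋯ + p_r are suffix sums, all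
-- multiples of c, and p = m·c.  As long as Σ eᵢ ≥ m, pigeonhole on the residues mod m
-- of the first k units of the gaps (0 ≤ k ≤ m) yields a nonzero set of gap units whose
-- weight is t·p for some t; removing them and raising x by t keeps f.  Finally
-- f_r − f₁ = (r − 1) + Σ eᵢ ≤ (r − 1) + m − 1, and c·(r − 1) + p_r ≤ p₂ + ⋯ + p_r + c
-- because c divides, hence is at most, every pᵢ.
module Submission where

open import Defs
open import Data.Nat using (ℕ; zero; suc; _+_; _*_; _∸_; _≤_; _<_; _⊓_; z≤n; NonZero; _%_; _/_; s≤s⁻¹; >-nonZero; >-nonZero⁻¹; z<s)
open import Data.Nat.Properties
open import Algebra.Properties.CommutativeSemigroup +-commutativeSemigroup using (interchange)
open import Data.Nat.DivMod using (m≡m%n+[m/n]*n; m%n<n)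
open import Data.Nat.Divisibility using (_∣_; divides; ∣⇒≤; ∣-trans; _∣0; ∣m∣n⇒∣m+n)
open import Data.Nat.GCD using (gcd[m,n]∣m; gcd[m,n]∣n)
open import Data.Nat.ListAction using (sum)
open import Data.List using (List; []; _∷_; length; map; zipWith; last; upTo)
open import Data.List.Properties using (filter-accept; filter-reject)
open import Data.List.Relation.Unary.Linked using (Linked; [-]; _∷_)
open import Data.List.Relation.Unary.All using (All; []; _∷_)
import Data.List.Relation.Unary.All as All
open import Data.List.Relation.Unary.All.Properties using (map⁺; applyUpTo⁺₁)
open import Data.List.Relation.Unary.AllPairs using (_∷_)
open import Data.List.Relation.Unary.Unique.Propositional using (Unique)
open import Data.List.Relation.Unary.Unique.Propositional.Properties using (upTo⁺)
open import Data.List.Relation.Binary.Pointwise using (Pointwise; []; _∷_; transitive)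
open import Data.Maybe using (just)
open import Data.Product using (Σ; ∃; ∃₂; _×_; _,_)
open import Data.Sum using (inj₁; inj₂)
open import Data.Fin using (Fin; toℕ; fromℕ<)
open import Data.Fin.Properties using (pigeonhole; toℕ<n; toℕ-fromℕ<)
open import Relation.Binary.PropositionalEquality
open import Relation.Nullary using (yes; no; ¬_)
open import Relation.Nullary.Negation using (contradiction)
open import Data.Nat.Solver using (module +-*-Solver)
open +-*-Solver

lastFrom : ℕ → List ℕ → ℕ
lastFrom a [] = a
lastFrom _ (b ∷ bs) = lastFrom b bs

last≡lastFrom : ∀ a bs → last (a ∷ bs) ≡ just (lastFrom a bs)
last≡lastFrom a [] = refl
last≡lastFrom a (b ∷ bs) = last≡lastFrom b bs

lastOr0-just : ∀ {s x} → last s ≡ just x → lastOr0 s ≡ x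
lastOr0-just eq rewrite eq = refl

numValues-just : ∀ {s x} → last s ≡ just x → numValues s ≡ suc x
numValues-just eq rewrite eq = refl

fromGaps : ℕ → List ℕ → List ℕ
fromGaps x [] = x ∷ []
fromGaps x (e ∷ es) = x ∷ fromGaps (x + suc e) es

length-fromGaps : ∀ x es → length (fromGaps x es) ≡ suc (length es)
length-fromGaps x [] = refl
length-fromGaps x (e ∷ es) = cong suc (length-fromGaps _ es)

fromGaps-increasing : ∀ x es → Linked _<_ (fromGaps x es)
fromGaps-increasing x [] = [-]
fromGaps-increasing x (e ∷ []) = m<m+n x z<s ∷ [-]
fromGaps-increasing x (e ∷ e′ ∷ es) = m<m+n x z<s ∷ fromGaps-increasing (x + suc e) (e′ ∷ es)

firstOr0-fromGaps : ∀ x es → firstOr0 (fromGaps x es) ≡ x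
firstOr0-fromGaps x [] = refl
firstOr0-fromGaps x (e ∷ es) = refl

last-fromGaps : ∀ x es → last (fromGaps x es) ≡ just (x + (length es + sum es))
last-fromGaps x [] = cong just (sym (+-identityʳ x))
last-fromGaps x (e ∷ []) =
  cong just (solve 2 (λ x e → x :+ (con 1 :+ e) := x :+ (con 1 :+ (e :+ con 0))) refl x e)
last-fromGaps x (e ∷ e′ ∷ es) = trans (last-fromGaps (x + suc e) (e′ ∷ es))
  (cong just (solve 4 (λ x e l s → (x :+ (con 1 :+ e)) :+ (con 1 :+ l :+ s)
                                   := x :+ (con 1 :+ (con 1 :+ l) :+ (e :+ s)))
                      refl x e (length es) (e′ + sum es)))

spread-fromGaps : ∀ x es → lastOr0 (fromGaps x es) ∸ firstOr0 (fromGaps x es) ≡ length es + sum es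
spread-fromGaps x es = trans
  (cong₂ _∸_ (lastOr0-just {fromGaps x es} (last-fromGaps x es)) (firstOr0-fromGaps x es)) (m+n∸m≡n x _)

toGaps : ∀ x fs → Linked _<_ (x ∷ fs) → ∃ λ es → x ∷ fs ≡ fromGaps x es
toGaps x [] _ = [] , refl
toGaps x (y ∷ fs) (x<y ∷ increasing) with es , eq ← toGaps y fs increasing =
  y ∸ suc x ∷ es , cong (x ∷_) (trans eq (cong (λ z → fromGaps z es) (sym x+gap≡y)))
  where
  x+gap≡y : x + suc (y ∸ suc x) ≡ y
  x+gap≡y = trans (+-suc x (y ∸ suc x)) (m+[n∸m]≡n x<y)

suffixSums : List ℕ → List ℕ
suffixSums [] = []
suffixSums (q ∷ qs) = sum (q ∷ qs) ∷ suffixSums qs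

weightedSum-fromGaps : ∀ p qs x es → length es ≡ length qs →
  weightedSum (p ∷ qs) (fromGaps x es)
    ≡ x * sum (p ∷ qs) + (sum (suffixSums qs) + weightedSum (suffixSums qs) es)
weightedSum-fromGaps p [] x [] _ =
  solve 2 (λ p x → p :* x :+ con 0 := x :* (p :+ con 0) :+ (con 0 :+ con 0)) refl p x
weightedSum-fromGaps p (q ∷ qs) x (e ∷ es) eq =
  trans (cong (p * x +_) (weightedSum-fromGaps q qs (x + suc e) es (suc-injective eq)))
    (solve 7 (λ p x e q Q A B → p :* x :+ ((x :+ (con 1 :+ e)) :* (q :+ Q) :+ (A :+ B))
                              := x :* (p :+ (q :+ Q)) :+ (((q :+ Q) :+ A) :+ ((q :+ Q) :* e :+ B)))
      refl p x e q (sum qs) (sum (suffixSums qs)) (weightedSum (suffixSums qs) es))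

weightedSum-∸ : ∀ ws {as bs} → Pointwise _≤_ as bs →
  weightedSum ws bs ≡ weightedSum ws as + weightedSum ws (zipWith _∸_ bs as)
weightedSum-∸ [] _ = refl
weightedSum-∸ (w ∷ ws) [] = refl
weightedSum-∸ (w ∷ ws) (_∷_ {a} {b} a≤b rest) = begin
  w * b + weightedSum ws _
    ≡⟨ cong₂ (λ u v → w * u + v) (sym (m+[n∸m]≡n a≤b)) (weightedSum-∸ ws rest) ⟩
  w * (a + (b ∸ a)) + (weightedSum ws _ + weightedSum ws _)
    ≡⟨ solve 5 (λ w a d X Y → w :* (a :+ d) :+ (X :+ Y) := (w :* a :+ X) :+ (w :* d :+ Y))
         refl w a (b ∸ a) _ _ ⟩
  (w * a + weightedSum ws _) + (w * (b ∸ a) + weightedSum ws _) ∎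
  where open ≡-Reasoning

sum-∸ : ∀ {as bs} → Pointwise _≤_ as bs → sum bs ≡ sum as + sum (zipWith _∸_ bs as)
sum-∸ [] = refl
sum-∸ (_∷_ {a} {b} a≤b rest) =
  trans (cong₂ _+_ (sym (m+[n∸m]≡n a≤b)) (sum-∸ rest)) (interchange a (b ∸ a) _ _)

sum-∸-< : ∀ {as bs} → Pointwise _≤_ as bs → 0 < sum as → sum (zipWith _∸_ bs as) < sum bs
sum-∸-< {as} {bs} as≤bs 0<Σas = subst (sum (zipWith _∸_ bs as) <_) (sym (sum-∸ as≤bs)) (m<n+m _ 0<Σas)

length-zipWith-∸ : ∀ {as bs} → Pointwise _≤_ as bs → length (zipWith _∸_ bs as) ≡ length bs
length-zipWith-∸ [] = refl
length-zipWith-∸ (_ ∷ rest) = cong suc (length-zipWith-∸ rest)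

zipWith-∸-≤ : ∀ {as bs} → Pointwise _≤_ as bs → Pointwise _≤_ (zipWith _∸_ bs as) bs
zipWith-∸-≤ [] = []
zipWith-∸-≤ (_∷_ {a} {b} _ rest) = m∸n≤m b a ∷ zipWith-∸-≤ rest

takeUnits : ℕ → List ℕ → List ℕ
takeUnits k [] = []
takeUnits k (e ∷ es) = e ⊓ k ∷ takeUnits (k ∸ e) es

takeUnits-≤ : ∀ k es → Pointwise _≤_ (takeUnits k es) es
takeUnits-≤ k [] = []
takeUnits-≤ k (e ∷ es) = m⊓n≤m e k ∷ takeUnits-≤ (k ∸ e) es

takeUnits-mono : ∀ {k k′} es → k ≤ k′ → Pointwise _≤_ (takeUnits k es) (takeUnits k′ es)
takeUnits-mono [] _ = []
takeUnits-mono (e ∷ es) k≤k′ = ⊓-monoʳ-≤ e k≤k′ ∷ takeUnits-mono es (∸-monoˡ-≤ e k≤k′)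

sum-takeUnits : ∀ k es → k ≤ sum es → sum (takeUnits k es) ≡ k
sum-takeUnits k [] k≤0 = sym (n≤0⇒n≡0 k≤0)
sum-takeUnits k (e ∷ es) k≤ =
  trans (cong (e ⊓ k +_) (sum-takeUnits (k ∸ e) es (m≤n+o⇒m∸n≤o k e k≤))) (m⊓n+n∸m≡n e k)

m%o≡[m+n]%o⇒o∣n : ∀ m n o .{{_ : NonZero o}} → m % o ≡ (m + n) % o → o ∣ n
m%o≡[m+n]%o⇒o∣n m n o eq = divides ((m + n) / o ∸ m / o) (begin
  n                                             ≡⟨ sym (m+n∸m≡n m n) ⟩
  (m + n) ∸ m                                   ≡⟨ cong₂ _∸_ (m≡m%n+[m/n]*n (m + n) o) (m≡m%n+[m/n]*n m o) ⟩
  ((m + n) % o + (m + n) / o * o) ∸ (m % o + m / o * o)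
    ≡⟨ cong (λ z → (z + (m + n) / o * o) ∸ (m % o + m / o * o)) (sym eq) ⟩
  (m % o + (m + n) / o * o) ∸ (m % o + m / o * o) ≡⟨ [m+n]∸[m+o]≡n∸o (m % o) _ _ ⟩
  (m + n) / o * o ∸ m / o * o                   ≡⟨ sym (*-distribʳ-∸ o ((m + n) / o) (m / o)) ⟩
  ((m + n) / o ∸ m / o) * o                     ∎)
  where open ≡-Reasoning

unitsBetween-divisible : ∀ m .{{_ : NonZero m}} ks es {k k′} → k < k′ → k′ ≤ sum es →
  weightedSum ks (takeUnits k es) % m ≡ weightedSum ks (takeUnits k′ es) % m →
  ∃ λ es₁ → Pointwise _≤_ es₁ es × 0 < sum es₁ × m ∣ weightedSum ks es₁
unitsBetween-divisible m ks es {k} {k′} k<k′ k′≤Σ sameResidue =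
  es₁ , transitive ≤-trans (zipWith-∸-≤ A≤B) (takeUnits-≤ k′ es) , nonempty , divisible
  where
  A = takeUnits k es
  B = takeUnits k′ es
  A≤B : Pointwise _≤_ A B
  A≤B = takeUnits-mono es (<⇒≤ k<k′)
  es₁ = zipWith _∸_ B A
  k′≡k+Σes₁ : k′ ≡ k + sum es₁
  k′≡k+Σes₁ = begin
    k′               ≡⟨ sym (sum-takeUnits k′ es k′≤Σ) ⟩
    sum B            ≡⟨ sum-∸ A≤B ⟩
    sum A + sum es₁  ≡⟨ cong (_+ sum es₁) (sum-takeUnits k es (≤-trans (<⇒≤ k<k′) k′≤Σ)) ⟩
    k + sum es₁      ∎
    where open ≡-Reasoning
  nonempty : 0 < sum es₁
  nonempty = +-cancelˡ-< k 0 (sum es₁) (subst₂ _<_ (sym (+-identityʳ k)) k′≡k+Σes₁ k<k′)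
  divisible : m ∣ weightedSum ks es₁
  divisible = m%o≡[m+n]%o⇒o∣n _ _ m (trans sameResidue (cong (_% m) (weightedSum-∸ ks A≤B)))

divisibleSubGaps : ∀ m .{{_ : NonZero m}} ks es → m ≤ sum es →
  ∃ λ es₁ → Pointwise _≤_ es₁ es × 0 < sum es₁ × m ∣ weightedSum ks es₁
divisibleSubGaps m ks es m≤Σ with pigeonhole (n<1+n m) residue
  where
  residue : Fin (suc m) → Fin m
  residue i = fromℕ< (m%n<n (weightedSum ks (takeUnits (toℕ i) es)) m)
... | i , j , i<j , sameResidue =
  unitsBetween-divisible m ks es i<j (≤-trans (s≤s⁻¹ (toℕ<n j)) m≤Σ)
    (trans (sym (toℕ-fromℕ< _)) (trans (cong toℕ sameResidue) (toℕ-fromℕ< _)))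

move-divisibleUnits : ∀ {m} ks x t {es₁ es} → Pointwise _≤_ es₁ es → weightedSum ks es₁ ≡ t * m →
  x * m + weightedSum ks es ≡ (x + t) * m + weightedSum ks (zipWith _∸_ es es₁)
move-divisibleUnits {m} ks x t {es₁} {es} es₁≤es W≡tm = begin
  x * m + W es              ≡⟨ cong (x * m +_) (weightedSum-∸ ks es₁≤es) ⟩
  x * m + (W es₁ + W rest)  ≡⟨ cong (λ z → x * m + (z + W rest)) W≡tm ⟩
  x * m + (t * m + W rest)  ≡⟨ sym (+-assoc (x * m) _ _) ⟩
  x * m + t * m + W rest    ≡⟨ cong (_+ W rest) (sym (*-distribʳ-+ m x t)) ⟩
  (x + t) * m + W rest      ∎
  where
  open ≡-Reasoning
  W = weightedSum ks
  rest = zipWith _∸_ es es₁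

reduceGaps : ∀ m .{{_ : NonZero m}} ks x es → ∃₂ λ x′ es′ →
  length es′ ≡ length es × x * m + weightedSum ks es ≡ x′ * m + weightedSum ks es′ × sum es′ < m
reduceGaps m ks x es = go (sum es) x es ≤-refl
  where
  W = weightedSum ks
  go : ∀ n x es → sum es ≤ n → ∃₂ λ x′ es′ →
    length es′ ≡ length es × x * m + W es ≡ x′ * m + W es′ × sum es′ < m
  go n x es Σ≤n with sum es <? m
  ... | yes small = x , es , refl , refl , small
  go zero x es Σ≤0 | no large = contradiction (≤-<-trans Σ≤0 (>-nonZero⁻¹ m)) large
  go (suc n) x es Σ≤n | no large with divisibleSubGaps m ks es (≮⇒≥ large)
  ... | es₁ , es₁≤es , nonempty , divides t W≡tm
    with go n (x + t) (zipWith _∸_ es es₁) (s≤s⁻¹ (<-≤-trans (sum-∸-< es₁≤es nonempty) Σ≤n))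
  ... | x′ , es′ , length≡ , invariant , small =
    x′ , es′ , trans length≡ (length-zipWith-∸ es₁≤es) ,
    trans (move-divisibleUnits ks x t es₁≤es W≡tm) invariant , small

gcdList-∣ : ∀ ps → All (gcdList ps ∣_) ps
gcdList-∣ [] = []
gcdList-∣ (p ∷ ps) = gcd[m,n]∣m p _ ∷ All.map (∣-trans (gcd[m,n]∣n p _)) (gcdList-∣ ps)

sum-∣ : ∀ {c ps} → All (c ∣_) ps → c ∣ sum ps
sum-∣ [] = _ ∣0
sum-∣ (d ∷ ds) = ∣m∣n⇒∣m+n d (sum-∣ ds)

suffixSums-∣ : ∀ {c ps} → All (c ∣_) ps → All (c ∣_) (suffixSums ps)
suffixSums-∣ [] = []
suffixSums-∣ (d ∷ ds) = sum-∣ (d ∷ ds) ∷ suffixSums-∣ ds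

weightedSum-factor : ∀ {c ws} → All (c ∣_) ws →
  ∃ λ ks → ∀ es → weightedSum ws es ≡ weightedSum ks es * c
weightedSum-factor [] = [] , λ _ → refl
weightedSum-factor {c} (divides q refl ∷ ds) with ks , factor ← weightedSum-factor ds =
  q ∷ ks , λ where
    [] → refl
    (e ∷ es) → trans (cong (q * c * e +_) (factor es))
      (solve 4 (λ q c e X → q :* c :* e :+ X :* c := (q :* e :+ X) :* c) refl q c e _)

weightedSum-fromGaps-factor : ∀ {c m ks} p qs x es → sum (p ∷ qs) ≡ m * c →
  (∀ es → weightedSum (suffixSums qs) es ≡ weightedSum ks es * c) → length es ≡ length qs →
  weightedSum (p ∷ qs) (fromGaps x es) ≡ (x * m + weightedSum ks es) * c + sum (suffixSums qs)
weightedSum-fromGaps-factor {c} {m} {ks} p qs x es P≡mc factor length≡ = begin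
  weightedSum (p ∷ qs) (fromGaps x es)
    ≡⟨ weightedSum-fromGaps p qs x es length≡ ⟩
  x * sum (p ∷ qs) + (K + weightedSum (suffixSums qs) es)
    ≡⟨ cong₂ (λ P W → x * P + (K + W)) P≡mc (factor es) ⟩
  x * (m * c) + (K + weightedSum ks es * c)
    ≡⟨ solve 5 (λ x m c K W → x :* (m :* c) :+ (K :+ W :* c) := (x :* m :+ W) :* c :+ K)
         refl x m c K (weightedSum ks es) ⟩
  (x * m + weightedSum ks es) * c + K ∎
  where
  open ≡-Reasoning
  K = sum (suffixSums qs)

c*length+last≤sum+c : ∀ c q t → All (c ≤_) (q ∷ t) → c * length (q ∷ t) + lastFrom q t ≤ sum (q ∷ t) + c
c*length+last≤sum+c c q [] (c≤q ∷ []) =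
  ≤-reflexive (solve 2 (λ c q → c :* con 1 :+ q := q :+ con 0 :+ c) refl c q)
c*length+last≤sum+c c q (q′ ∷ t) (c≤q ∷ rest) = begin
  c * suc (suc (length t)) + lastFrom q′ t
    ≡⟨ solve 3 (λ c l x → c :* (con 1 :+ (con 1 :+ l)) :+ x := c :+ (c :* (con 1 :+ l) :+ x))
         refl c (length t) (lastFrom q′ t) ⟩
  c + (c * suc (length t) + lastFrom q′ t) ≤⟨ +-mono-≤ c≤q (c*length+last≤sum+c c q′ t rest) ⟩
  q + (sum (q′ ∷ t) + c)                   ≡⟨ sym (+-assoc q _ c) ⟩
  q + sum (q′ ∷ t) + c                     ∎
  where open ≤-Reasoning

spreadBound : ∀ {c m s} p q t L → All (c ≤_) (q ∷ t) → s < m → sum (p ∷ q ∷ t) ≡ m * c →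
  sum (p ∷ q ∷ t) ≤ L → c * (length (q ∷ t) + s) ≤ 2 * L ∸ (p + lastFrom q t)
spreadBound {c} {m} {s} p q t L c≤qs s<m P≡mc P≤L =
  m+n≤o⇒m≤o∸n (c * (length qs + s)) (begin
    c * (length qs + s) + (p + lastFrom q t)
      ≡⟨ solve 5 (λ c l s p x → c :* (l :+ s) :+ (p :+ x) := (c :* l :+ x) :+ (p :+ s :* c))
           refl c (length qs) s p (lastFrom q t) ⟩
    (c * length qs + lastFrom q t) + (p + s * c) ≤⟨ +-monoˡ-≤ _ (c*length+last≤sum+c c q t c≤qs) ⟩
    (sum qs + c) + (p + s * c)
      ≡⟨ solve 4 (λ Q c p sc → (Q :+ c) :+ (p :+ sc) := (p :+ Q) :+ (sc :+ c)) refl (sum qs) c p (s * c) ⟩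
    P + (s * c + c)                              ≡⟨ cong (P +_) (+-comm (s * c) c) ⟩
    P + suc s * c                                ≤⟨ +-monoʳ-≤ P (≤-trans (*-monoˡ-≤ c s<m) (≤-reflexive (sym P≡mc))) ⟩
    P + P                                        ≤⟨ +-mono-≤ P≤L P≤L ⟩
    L + L                                        ≡⟨ cong (L +_) (sym (+-identityʳ L)) ⟩
    2 * L                                        ∎)
  where
  open ≤-Reasoning
  qs = q ∷ t
  P = sum (p ∷ qs)

reducedSolution : ∀ {c m ks} p qs .{{_ : NonZero m}} → sum (p ∷ qs) ≡ m * c →
  (∀ es → weightedSum (suffixSums qs) es ≡ weightedSum ks es * c) →
  ∀ {f} x es → IsGeneralSolution (p ∷ qs) f (fromGaps x es) → ∃₂ λ x′ es′ →
    IsGeneralSolution (p ∷ qs) f (fromGaps x′ es′) × length es′ ≡ length qs × sum es′ < m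
reducedSolution {c} {m} {ks} p qs P≡mc factor {f} x es (length≡ , _ , weighted)
  with x′ , es′ , length≡′ , invariant , small ← reduceGaps m ks x es =
  x′ , es′ , (length-gs , fromGaps-increasing x′ es′ , weighted′) , trans length≡′ length-es , small
  where
  length-es : length es ≡ length qs
  length-es = suc-injective (trans (sym (length-fromGaps x es)) length≡)
  length-gs : length (fromGaps x′ es′) ≡ length (p ∷ qs)
  length-gs = trans (length-fromGaps x′ es′) (cong suc (trans length≡′ length-es))
  weighted′ : weightedSum (p ∷ qs) (fromGaps x′ es′) ≡ f
  weighted′ = begin
    weightedSum (p ∷ qs) (fromGaps x′ es′)
      ≡⟨ weightedSum-fromGaps-factor {c} {m} {ks} p qs x′ es′ P≡mc factor (trans length≡′ length-es) ⟩
    (x′ * m + weightedSum ks es′) * c + sum (suffixSums qs)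
      ≡⟨ cong (λ z → z * c + sum (suffixSums qs)) (sym invariant) ⟩
    (x * m + weightedSum ks es) * c + sum (suffixSums qs)
      ≡⟨ sym (weightedSum-fromGaps-factor {c} {m} {ks} p qs x es P≡mc factor length-es) ⟩
    weightedSum (p ∷ qs) (fromGaps x es) ≡⟨ weighted ⟩
    f ∎
    where open ≡-Reasoning

boundedGeneralSolution : ∀ ps L → All (0 <_) ps → sum ps ≤ L → ∀ f →
  Σ (List ℕ) (λ fs → IsGeneralSolution ps f fs) →
  Σ (List ℕ) (λ gs → IsGeneralSolution ps f gs ×
    (gcdList ps * (lastOr0 gs ∸ firstOr0 gs) ≤ 2 * L ∸ (firstOr0 ps + lastOr0 ps)))
boundedGeneralSolution [] L _ _ f ([] , solution) = [] , solution , z≤n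
boundedGeneralSolution (p ∷ []) L _ _ f (x ∷ [] , solution) =
  x ∷ [] , solution , subst (_≤ 2 * L ∸ (p + p)) (sym c*[x∸x]≡0) z≤n
  where
  c*[x∸x]≡0 : gcdList (p ∷ []) * (x ∸ x) ≡ 0
  c*[x∸x]≡0 = trans (cong (gcdList (p ∷ []) *_) (n∸n≡0 x)) (*-zeroʳ (gcdList (p ∷ [])))
boundedGeneralSolution ps@(p ∷ qs@(q ∷ t)) L (0<p ∷ 0<qs) P≤L f (x ∷ fs , solution@(_ , increasing , _))
  with es , gaps ← toGaps x fs increasing
  with sum-∣ (gcdList-∣ ps)
... | divides zero P≡0 = contradiction (≤-trans 0<p (≤-trans (m≤m+n p _) (≤-reflexive P≡0))) λ ()
... | divides m@(suc _) P≡mc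
  with ks , factor ← weightedSum-factor (suffixSums-∣ (All.tail (gcdList-∣ ps)))
  = bounded (reducedSolution {c} {m} {ks} p qs P≡mc factor x es (subst (IsGeneralSolution ps f) gaps solution))
  where
  c = gcdList ps
  c≤qs : All (c ≤_) qs
  c≤qs = All.zipWith (λ { (c∣q , 0<q) → ∣⇒≤ {{>-nonZero 0<q}} c∣q }) (All.tail (gcdList-∣ ps) , 0<qs)
  bounded : (∃₂ λ x′ es′ → IsGeneralSolution ps f (fromGaps x′ es′) × length es′ ≡ length qs × sum es′ < m) →
    Σ (List ℕ) (λ gs → IsGeneralSolution ps f gs × c * (lastOr0 gs ∸ firstOr0 gs) ≤ 2 * L ∸ (p + lastOr0 ps))
  bounded (x′ , es′ , solution′ , length≡ , small) = fromGaps x′ es′ , solution′ ,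
    subst₂ (λ d l → c * d ≤ 2 * L ∸ (p + l))
      (sym (trans (spread-fromGaps x′ es′) (cong (_+ sum es′) length≡)))
      (sym (lastOr0-just {ps} (last≡lastFrom p qs)))
      (spreadBound p q t L c≤qs small P≡mc P≤L)

count-accept : ∀ {v x} s → x ≡ v → count v (x ∷ s) ≡ suc (count v s)
count-accept {v} _ x≡v = cong length (filter-accept (λ y → y ≟ v) x≡v)

count-reject : ∀ {v x} s → ¬ x ≡ v → count v (x ∷ s) ≡ count v s
count-reject {v} _ x≢v = cong length (filter-reject (λ y → y ≟ v) x≢v)

count-∷ : ∀ v x s → count v (x ∷ s) ≡ count v (x ∷ []) + count v s
count-∷ v x s with x ≟ v
... | yes x≡v = trans (count-accept s x≡v) (cong (_+ count v s) (sym (count-accept [] x≡v)))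
... | no x≢v = trans (count-reject s x≢v) (cong (_+ count v s) (sym (count-reject [] x≢v)))

count-head : ∀ v s → 0 < count v (v ∷ s)
count-head v s = subst (0 <_) (sym (count-accept {v} s refl)) z<s

count-positive : ∀ a t v → Linked Step (a ∷ t) → a ≤ v → v ≤ lastFrom a t → 0 < count v (a ∷ t)
count-positive a [] v _ a≤v v≤a with ≤-antisym v≤a a≤v
... | refl = count-head v []
count-positive a (b ∷ t) v (step ∷ steps) a≤v v≤last with v ≟ a
... | yes refl = count-head v (b ∷ t)
... | no v≢a = ≤-trans (count-positive b t v steps (b≤v step) v≤last)
                       (≤-trans (m≤n+m _ _) (≤-reflexive (sym (count-∷ v a (b ∷ t)))))
  where
  b≤v : Step a b → b ≤ v
  b≤v (inj₁ refl) = a≤v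
  b≤v (inj₂ refl) = ≤∧≢⇒< a≤v (λ a≡v → v≢a (sym a≡v))

sum-count-∷ : ∀ x s vs →
  sum (map (λ v → count v (x ∷ s)) vs) ≡ sum (map (λ v → count v (x ∷ [])) vs) + sum (map (λ v → count v s) vs)
sum-count-∷ x s [] = refl
sum-count-∷ x s (v ∷ vs) =
  trans (cong₂ _+_ (count-∷ v x s) (sum-count-∷ x s vs)) (interchange (count v (x ∷ [])) _ _ _)

sum-count-singleton≡0 : ∀ x {vs} → All (λ v → ¬ x ≡ v) vs → sum (map (λ v → count v (x ∷ [])) vs) ≡ 0
sum-count-singleton≡0 x [] = refl
sum-count-singleton≡0 x (x≢v ∷ rest) = cong₂ _+_ (count-reject [] x≢v) (sum-count-singleton≡0 x rest)

sum-count-singleton≤1 : ∀ x {vs} → Unique vs → sum (map (λ v → count v (x ∷ [])) vs) ≤ 1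
sum-count-singleton≤1 x {[]} _ = z≤n
sum-count-singleton≤1 x {v ∷ _} (v≢rest ∷ unique) with x ≟ v
... | yes refl = ≤-reflexive (cong₂ _+_ (count-accept {x} [] refl) (sum-count-singleton≡0 x v≢rest))
... | no x≢v = subst (_≤ 1) (sym (cong (_+ _) (count-reject [] x≢v))) (sum-count-singleton≤1 x unique)

sum-count≤length : ∀ {vs} → Unique vs → ∀ s → sum (map (λ v → count v s) vs) ≤ length s
sum-count≤length {vs} _ [] = ≤-reflexive (sum-count-[] vs)
  where
  sum-count-[] : ∀ vs → sum (map (λ v → count v []) vs) ≡ 0
  sum-count-[] [] = refl
  sum-count-[] (_ ∷ vs) = sum-count-[] vs
sum-count≤length {vs} unique (x ∷ s) = begin
  sum (map (λ v → count v (x ∷ s)) vs)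
    ≡⟨ sum-count-∷ x s vs ⟩
  sum (map (λ v → count v (x ∷ [])) vs) + sum (map (λ v → count v s) vs)
    ≤⟨ +-mono-≤ (sum-count-singleton≤1 x unique) (sum-count≤length unique s) ⟩
  suc (length s) ∎
  where open ≤-Reasoning

sum-multiplicities≤length : ∀ s → sum (multiplicities s) ≤ length s
sum-multiplicities≤length s = sum-count≤length (upTo⁺ (numValues s)) s

multiplicities-positive : ∀ t → Linked Step (0 ∷ t) → All (0 <_) (multiplicities (0 ∷ t))
multiplicities-positive t steps =
  subst (λ n → All (0 <_) (map (λ v → count v (0 ∷ t)) (upTo n)))
    (sym (numValues-just {0 ∷ t} (last≡lastFrom 0 t)))
    (map⁺ (applyUpTo⁺₁ (λ i → i) (suc (lastFrom 0 t))
      (λ i<r → count-positive 0 t _ steps z≤n (s≤s⁻¹ i<r))))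

mainTheorem8 : (s : List ℕ) → IsSortingSequence s → 1 < numValues s →
    (f : ℕ) → Σ (List ℕ) (λ fs → IsGeneralSolution (multiplicities s) f fs) →
    Σ (List ℕ) (λ gs → IsGeneralSolution (multiplicities s) f gs ×
    (gcdList (multiplicities s) * (lastOr0 gs ∸ firstOr0 gs)
    ≤ (2 * length s) ∸ (firstOr0 (multiplicities s) + lastOr0 (multiplicities s))))
mainTheorem8 [] (() , _) _
mainTheorem8 (suc _ ∷ _) (() , _) _
mainTheorem8 s@(zero ∷ t) (_ , steps) _ =
  boundedGeneralSolution (multiplicities s) (length s)
    (multiplicities-positive t steps) (sum-multiplicities≤length s)
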